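{- Let $\mathrm{Sha}=\mathcal{R}(C(t),tC^2(t))$ be the Shapiro array. Then $$\mathrm{Der}(\mathrm{Sha})=\mathcal{R}(C'(t),\,tC(t)),\qquad (\mathrm{Der}(\mathrm{Sha}))^{ -1}=\mathcal{R}\big((1-t)^2(1-2t),\,t-t^2\big),$$ and for all $n\ge k\ge0$ the $(n,k)$-entry of $\mathrm{Der}(\mathrm{Sha})$ is $\binom{2n-k+2}{n-k}$.
   Context: $C(t)=\frac{1-\sqrt{1-4t}}{2t}$ is the Catalan generating function, satisfying $tC(t)^2=C(t)-1$. For formal power series $d(t),h(t)$ with $d(0)\neq0$, $h(0)=0$, $h'(0)\neq0$, $\mathcal{R}(d(t),h(t))$ is the infinite lower triangular matrix with $(n,k)$-entry $[t^n]\,d(t)h(t)^k$ ($n,k\ge0$); inverses are matrix inverses. $\mathrm{Der}(\mathcal{R}(d(t),h(t)))=\mathcal{R}(h'(t),t\,d(t))$. -}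

module Defs where

open import Data.Nat using (ℕ; zero; suc; _∸_)
open import Data.Integer using (ℤ; +_; _+_; _*_; _-_)

Series : Set
Series = ℕ → ℤ

-- Infinite matrices indexed by ℕ × ℕ (row n, column k).
Matrix : Set
Matrix = ℕ → ℕ → ℤ

sumTo : ℕ → (ℕ → ℤ) → ℤ
sumTo zero    f = f zero
sumTo (suc n) f = sumTo n f + f (suc n)

one : Series
one zero    = + 1
one (suc _) = + 0

X : Series
X (suc zero) = + 1
X _          = + 0

infixl 6 _⊕_ _⊖_
infixl 7 _⊛_

_⊕_ : Series → Series → Series
(f ⊕ g) n = f n + g n

_⊖_ : Series → Series → Series
(f ⊖ g) n = f n - g n

_⊛_ : Series → Series → Series
(f ⊛ g) n = sumTo n (λ i → f i * g (n ∸ i))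

pow : Series → ℕ → Series
pow f zero    = one
pow f (suc k) = f ⊛ pow f k

deriv : Series → Series
deriv f n = + (suc n) * f (suc n)

riordan : Series → Series → Matrix
riordan d h n k = (d ⊛ pow h k) n

Der : Series → Series → Matrix
Der d h = riordan (deriv h) (X ⊛ d)

-- product of lower-triangular matrices: (MN)(n,k) = Σ_{j=0}^{n} M(n,j) N(j,k)
_⊠_ : Matrix → Matrix → Matrix
(M ⊠ N) n k = sumTo n (λ j → M n j * N j k)

idM : Matrix
idM zero    zero    = + 1
idM zero    (suc _) = + 0
idM (suc _) zero    = + 0
idM (suc n) (suc k) = idM n k

IsInverse : Matrix → Matrix → Set
IsInverse M N = (∀ n k → (M ⊠ N) n k ≡ idM n k) × (∀ n k → (N ⊠ M) n k ≡ idM n k)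
  where
  open import Relation.Binary.PropositionalEquality using (_≡_)
  open import Data.Product using (_×_)

module Submission where

-- With h = tC and D = (tC²)', the relation tC² = C - 1 gives h² = h - t and C (1 - h) = 1, and its
-- derivative gives D (1 - 2h) = C², hence D (1 - h)² (1 - 2h) = 1. Read coefficientwise, the columns of
-- Der(Sha) = R(D, h) obey a Pascal-type recurrence and a four-term relation in column 0, and these two
-- relations alone force A · R((1 - t)²(1 - 2t), t - t²) = I row by row. That factor is unit lower
-- triangular, so such an A is unique and is also a left inverse; the binomial array satisfies the same
-- two relations, which identifies the entries.

open import Defs

module Riordan where

  open import Data.Nat as ℕ using (ℕ; zero; suc; _∸_; _≤_; _<_; z≤n; s≤s)
  import Data.Nat.Properties as ℕ
  open import Data.Nat.Combinatorics using (_C_; nCk≡nC[n∸k]; nCk+nC[k+1]≡[n+1]C[k+1]; k>n⇒nCk≡0)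
  open import Data.Nat.Tactic.RingSolver using () renaming (solve-∀ to ℕ-solve-∀)
  open import Data.Integer using (ℤ; +_; _+_; _*_; _-_; -_; _^_)
  open import Data.Integer.Properties
  open import Data.Integer.Tactic.RingSolver using (solve-∀)
  open import Data.Product using (_,_)
  open import Data.Empty using (⊥-elim)
  open import Data.Maybe using (just; nothing)
  open import Function using (_∘_)
  open import Relation.Nullary using (yes; no)
  open import Relation.Binary.Definitions using (WeaklyDecidable; tri<; tri≈; tri>)
  open import Relation.Binary.PropositionalEquality
  open import Algebra.Bundles using (RawRing; CommutativeRing)
  open import Algebra.Structures using (IsCommutativeSemiring)
  open import Algebra.Solver.Ring.AlmostCommutativeRing
    using (AlmostCommutativeRing; _-Raw-AlmostCommutative⟶_; Induced-equivalence)
  import Algebra.Solver.Ring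

  open ≡-Reasoning

  -- Finite sums

  sumTo-cong : ∀ n {F G : ℕ → ℤ} → (∀ i → F i ≡ G i) → sumTo n F ≡ sumTo n G
  sumTo-cong zero    F≡G = F≡G zero
  sumTo-cong (suc n) F≡G = cong₂ _+_ (sumTo-cong n F≡G) (F≡G (suc n))

  sumTo-cong-≤ : ∀ n {F G : ℕ → ℤ} → (∀ i → i ≤ n → F i ≡ G i) → sumTo n F ≡ sumTo n G
  sumTo-cong-≤ zero    F≡G = F≡G zero z≤n
  sumTo-cong-≤ (suc n) F≡G =
    cong₂ _+_ (sumTo-cong-≤ n (λ i i≤n → F≡G i (ℕ.m≤n⇒m≤1+n i≤n))) (F≡G (suc n) ℕ.≤-refl)

  sumTo-zero : ∀ n {F : ℕ → ℤ} → (∀ i → i ≤ n → F i ≡ + 0) → sumTo n F ≡ + 0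
  sumTo-zero zero    F≡0 = F≡0 zero z≤n
  sumTo-zero (suc n) F≡0 =
    cong₂ _+_ (sumTo-zero n (λ i i≤n → F≡0 i (ℕ.m≤n⇒m≤1+n i≤n))) (F≡0 (suc n) ℕ.≤-refl)

  sumTo-single : ∀ n {k} {F : ℕ → ℤ} → k ≤ n → (∀ i → i ≤ n → i ≢ k → F i ≡ + 0) →
    sumTo n F ≡ F k
  sumTo-single zero    z≤n F≡0 = refl
  sumTo-single (suc n) {k} {F} k≤1+n F≡0 with k ℕ.≟ suc n
  ... | yes refl =
    trans (cong (_+ F k) (sumTo-zero n (λ i i≤n → F≡0 i (ℕ.m≤n⇒m≤1+n i≤n) (ℕ.<⇒≢ (s≤s i≤n)))))
          (+-identityˡ (F k))
  ... | no k≢1+n =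
    trans (cong₂ _+_ (sumTo-single n (ℕ.≤-pred (ℕ.≤∧≢⇒< k≤1+n k≢1+n))
                                     (λ i i≤n → F≡0 i (ℕ.m≤n⇒m≤1+n i≤n)))
                     (F≡0 (suc n) ℕ.≤-refl (k≢1+n ∘ sym)))
          (+-identityʳ (F k))

  sumTo-distrib-+ : ∀ n (F G : ℕ → ℤ) → sumTo n (λ i → F i + G i) ≡ sumTo n F + sumTo n G
  sumTo-distrib-+ zero    F G = refl
  sumTo-distrib-+ (suc n) F G = begin
    sumTo n (λ i → F i + G i) + (F (suc n) + G (suc n))
      ≡⟨ cong (_+ (F (suc n) + G (suc n))) (sumTo-distrib-+ n F G) ⟩
    (sumTo n F + sumTo n G) + (F (suc n) + G (suc n))
      ≡⟨ +-interchange (sumTo n F) (sumTo n G) (F (suc n)) (G (suc n)) ⟩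
    (sumTo n F + F (suc n)) + (sumTo n G + G (suc n)) ∎
    where
    +-interchange : ∀ a b c d → (a + b) + (c + d) ≡ (a + c) + (b + d)
    +-interchange a b c d = begin
      (a + b) + (c + d) ≡⟨ +-assoc a b (c + d) ⟩
      a + (b + (c + d)) ≡⟨ cong (_+_ a) (sym (+-assoc b c d)) ⟩
      a + ((b + c) + d) ≡⟨ cong (λ z → a + (z + d)) (+-comm b c) ⟩
      a + ((c + b) + d) ≡⟨ cong (_+_ a) (+-assoc c b d) ⟩
      a + (c + (b + d)) ≡⟨ sym (+-assoc a c (b + d)) ⟩
      (a + c) + (b + d) ∎

  *-distribˡ-sumTo : ∀ n a (F : ℕ → ℤ) → a * sumTo n F ≡ sumTo n (λ i → a * F i)
  *-distribˡ-sumTo zero    a F = refl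
  *-distribˡ-sumTo (suc n) a F =
    trans (*-distribˡ-+ a (sumTo n F) (F (suc n))) (cong (_+ a * F (suc n)) (*-distribˡ-sumTo n a F))

  *-distribʳ-sumTo : ∀ n a (F : ℕ → ℤ) → sumTo n F * a ≡ sumTo n (λ i → F i * a)
  *-distribʳ-sumTo n a F = begin
    sumTo n F * a             ≡⟨ *-comm (sumTo n F) a ⟩
    a * sumTo n F             ≡⟨ *-distribˡ-sumTo n a F ⟩
    sumTo n (λ i → a * F i)   ≡⟨ sumTo-cong n (λ i → *-comm a (F i)) ⟩
    sumTo n (λ i → F i * a)   ∎

  neg-distrib-sumTo : ∀ n (F : ℕ → ℤ) → - sumTo n F ≡ sumTo n (λ i → - F i)
  neg-distrib-sumTo n F = begin
    - sumTo n F                  ≡⟨ sym (-1*i≡-i (sumTo n F)) ⟩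
    - + 1 * sumTo n F            ≡⟨ *-distribˡ-sumTo n (- + 1) F ⟩
    sumTo n (λ i → - + 1 * F i)  ≡⟨ sumTo-cong n (λ i → -1*i≡-i (F i)) ⟩
    sumTo n (λ i → - F i)        ∎

  sumTo-distrib-- : ∀ n (F G : ℕ → ℤ) → sumTo n (λ i → F i - G i) ≡ sumTo n F - sumTo n G
  sumTo-distrib-- n F G =
    trans (sumTo-distrib-+ n F (λ i → - G i)) (cong (_+_ (sumTo n F)) (sym (neg-distrib-sumTo n G)))

  sumTo-suc-first : ∀ n (F : ℕ → ℤ) → sumTo (suc n) F ≡ F 0 + sumTo n (F ∘ suc)
  sumTo-suc-first zero    F = refl
  sumTo-suc-first (suc n) F =
    trans (cong (_+ F (suc (suc n))) (sumTo-suc-first n F)) (+-assoc (F 0) _ _)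

  sumTo-reverse : ∀ n (F : ℕ → ℤ) → sumTo n F ≡ sumTo n (λ i → F (n ∸ i))
  sumTo-reverse zero    F = refl
  sumTo-reverse (suc n) F = begin
    sumTo n F + F (suc n)                   ≡⟨ +-comm (sumTo n F) (F (suc n)) ⟩
    F (suc n) + sumTo n F                   ≡⟨ cong (_+_ (F (suc n))) (sumTo-reverse n F) ⟩
    F (suc n) + sumTo n (λ i → F (n ∸ i))   ≡⟨ sym (sumTo-suc-first n (λ i → F (suc n ∸ i))) ⟩
    sumTo (suc n) (λ i → F (suc n ∸ i))     ∎

  sumTo-truncate : ∀ {m} n {F : ℕ → ℤ} → m ≤ n → (∀ i → m < i → F i ≡ + 0) → sumTo n F ≡ sumTo m F
  sumTo-truncate zero    z≤n _ = refl
  sumTo-truncate {m} (suc n) {F} m≤1+n F≡0 with m ℕ.≟ suc n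
  ... | yes refl = refl
  ... | no m≢1+n =
    trans (cong₂ _+_ (sumTo-truncate n m≤n F≡0) (F≡0 (suc n) (s≤s m≤n))) (+-identityʳ (sumTo m F))
    where m≤n = ℕ.≤-pred (ℕ.≤∧≢⇒< m≤1+n m≢1+n)

  sumTo-swap : ∀ m n (F : ℕ → ℕ → ℤ) →
    sumTo m (λ i → sumTo n (F i)) ≡ sumTo n (λ j → sumTo m (λ i → F i j))
  sumTo-swap zero    n F = refl
  sumTo-swap (suc m) n F =
    trans (cong (_+ sumTo n (F (suc m))) (sumTo-swap m n F))
          (sym (sumTo-distrib-+ n (λ j → sumTo m (λ i → F i j)) (F (suc m))))

  sumTo-triangle : ∀ n (F : ℕ → ℕ → ℤ) →
    sumTo n (λ i → sumTo i (F i)) ≡ sumTo n (λ j → sumTo (n ∸ j) (λ l → F (j ℕ.+ l) j))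
  sumTo-triangle zero    F = refl
  sumTo-triangle (suc n) F = begin
    sumTo n (λ i → sumTo i (F i)) + sumTo (suc n) (F (suc n))
      ≡⟨ cong (_+ sumTo (suc n) (F (suc n))) (sumTo-triangle n F) ⟩
    sumTo n G + (sumTo n (F (suc n)) + F (suc n) (suc n))
      ≡⟨ sym (+-assoc (sumTo n G) (sumTo n (F (suc n))) (F (suc n) (suc n))) ⟩
    (sumTo n G + sumTo n (F (suc n))) + F (suc n) (suc n)
      ≡⟨ cong (_+ F (suc n) (suc n)) (sym (sumTo-distrib-+ n G (F (suc n)))) ⟩
    sumTo n (λ j → G j + F (suc n) j) + F (suc n) (suc n)
      ≡⟨ cong₂ _+_ (sumTo-cong-≤ n grow) (cong (λ m → F m (suc n)) (sym (ℕ.+-identityʳ (suc n)))) ⟩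
    sumTo n G′ + F (suc n ℕ.+ 0) (suc n)
      ≡⟨ cong (λ m → sumTo n G′ + sumTo m (λ l → F (suc n ℕ.+ l) (suc n))) (sym (ℕ.n∸n≡0 n)) ⟩
    sumTo (suc n) G′ ∎
    where
    G G′ : ℕ → ℤ
    G  j = sumTo (n ∸ j) (λ l → F (j ℕ.+ l) j)
    G′ j = sumTo (suc n ∸ j) (λ l → F (j ℕ.+ l) j)
    grow : ∀ j → j ≤ n → G j + F (suc n) j ≡ G′ j
    grow j j≤n rewrite ℕ.+-∸-assoc 1 j≤n =
      cong (λ m → G j + F m j) (sym (trans (ℕ.+-suc j (n ∸ j)) (cong suc (ℕ.m+[n∸m]≡n j≤n))))

  -- Formal power series

  infix 4 _≈_
  _≈_ : Series → Series → Set
  f ≈ g = ∀ n → f n ≡ g n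

  ≈-refl : ∀ {f} → f ≈ f
  ≈-refl n = refl

  ≈-sym : ∀ {f g} → f ≈ g → g ≈ f
  ≈-sym f≈g n = sym (f≈g n)

  ≈-trans : ∀ {f g h} → f ≈ g → g ≈ h → f ≈ h
  ≈-trans f≈g g≈h n = trans (f≈g n) (g≈h n)

  zeroS : Series
  zeroS _ = + 0

  negS : Series → Series
  negS f n = - f n

  ⊕-cong : ∀ {f f′ g g′} → f ≈ f′ → g ≈ g′ → f ⊕ g ≈ f′ ⊕ g′
  ⊕-cong f≈f′ g≈g′ n = cong₂ _+_ (f≈f′ n) (g≈g′ n)

  ⊖-cong : ∀ {f f′ g g′} → f ≈ f′ → g ≈ g′ → f ⊖ g ≈ f′ ⊖ g′
  ⊖-cong f≈f′ g≈g′ n = cong₂ _-_ (f≈f′ n) (g≈g′ n)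

  ⊛-cong : ∀ {f f′ g g′} → f ≈ f′ → g ≈ g′ → f ⊛ g ≈ f′ ⊛ g′
  ⊛-cong f≈f′ g≈g′ n = sumTo-cong n (λ i → cong₂ _*_ (f≈f′ i) (g≈g′ (n ∸ i)))

  ⊛-comm : ∀ f g → f ⊛ g ≈ g ⊛ f
  ⊛-comm f g n = trans (sumTo-reverse n _) (sumTo-cong-≤ n λ i i≤n →
    trans (cong (λ m → f (n ∸ i) * g m) (ℕ.m∸[m∸n]≡n i≤n)) (*-comm (f (n ∸ i)) (g i)))

  ⊛-assoc : ∀ f g h → (f ⊛ g) ⊛ h ≈ f ⊛ (g ⊛ h)
  ⊛-assoc f g h n = begin
    sumTo n (λ i → sumTo i (λ j → f j * g (i ∸ j)) * h (n ∸ i))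
      ≡⟨ sumTo-cong n (λ i → *-distribʳ-sumTo i (h (n ∸ i)) (λ j → f j * g (i ∸ j))) ⟩
    sumTo n (λ i → sumTo i (λ j → f j * g (i ∸ j) * h (n ∸ i)))
      ≡⟨ sumTo-triangle n (λ i j → f j * g (i ∸ j) * h (n ∸ i)) ⟩
    sumTo n (λ j → sumTo (n ∸ j) (λ l → f j * g ((j ℕ.+ l) ∸ j) * h (n ∸ (j ℕ.+ l))))
      ≡⟨ sumTo-cong n (λ j → trans (sumTo-cong (n ∸ j) (reassociate j))
                                   (sym (*-distribˡ-sumTo (n ∸ j) (f j) _))) ⟩
    sumTo n (λ j → f j * sumTo (n ∸ j) (λ l → g l * h ((n ∸ j) ∸ l))) ∎
    where
    reassociate : ∀ j l → f j * g ((j ℕ.+ l) ∸ j) * h (n ∸ (j ℕ.+ l)) ≡ f j * (g l * h ((n ∸ j) ∸ l))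
    reassociate j l rewrite ℕ.m+n∸m≡n j l | ℕ.∸-+-assoc n j l = *-assoc (f j) (g l) (h (n ∸ (j ℕ.+ l)))

  ⊛-distribˡ-⊕ : ∀ f g h → f ⊛ (g ⊕ h) ≈ (f ⊛ g) ⊕ (f ⊛ h)
  ⊛-distribˡ-⊕ f g h n =
    trans (sumTo-cong n (λ i → *-distribˡ-+ (f i) (g (n ∸ i)) (h (n ∸ i)))) (sumTo-distrib-+ n _ _)

  ⊛-distribʳ-⊕ : ∀ f g h → (g ⊕ h) ⊛ f ≈ (g ⊛ f) ⊕ (h ⊛ f)
  ⊛-distribʳ-⊕ f g h n =
    trans (sumTo-cong n (λ i → *-distribʳ-+ (f (n ∸ i)) (g i) (h i))) (sumTo-distrib-+ n _ _)

  ⊛-zeroˡ : ∀ f → zeroS ⊛ f ≈ zeroS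
  ⊛-zeroˡ f n = sumTo-zero n (λ i _ → refl)

  ⊛-zeroʳ : ∀ f → f ⊛ zeroS ≈ zeroS
  ⊛-zeroʳ f n = sumTo-zero n (λ i _ → *-zeroʳ (f i))

  negS-⊛ : ∀ f g → negS f ⊛ g ≈ negS (f ⊛ g)
  negS-⊛ f g n = trans (sumTo-cong n (λ i → sym (neg-distribˡ-* (f i) (g (n ∸ i)))))
                       (sym (neg-distrib-sumTo n _))

  κ : ℤ → Series
  κ a zero    = a
  κ a (suc _) = + 0

  κ-⊛ : ∀ a f → κ a ⊛ f ≈ (λ n → a * f n)
  κ-⊛ a f n = sumTo-single n z≤n κ-off
    where
    κ-off : ∀ i → i ≤ n → i ≢ 0 → κ a i * f (n ∸ i) ≡ + 0
    κ-off zero    _ 0≢0 = ⊥-elim (0≢0 refl)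
    κ-off (suc i) _ _   = refl

  ⊛-identityˡ : ∀ f → one ⊛ f ≈ f
  ⊛-identityˡ f n = trans (sumTo-single n z≤n one-off) (*-identityˡ (f n))
    where
    one-off : ∀ i → i ≤ n → i ≢ 0 → one i * f (n ∸ i) ≡ + 0
    one-off zero    _ 0≢0 = ⊥-elim (0≢0 refl)
    one-off (suc i) _ _   = refl

  ⊛-identityʳ : ∀ f → f ⊛ one ≈ f
  ⊛-identityʳ f n = trans (⊛-comm f one n) (⊛-identityˡ f n)

  X-⊛-suc : ∀ f n → (X ⊛ f) (suc n) ≡ f n
  X-⊛-suc f n = trans (sumTo-single (suc n) (s≤s z≤n) X-off) (*-identityˡ (f n))
    where
    X-off : ∀ i → i ≤ suc n → i ≢ 1 → X i * f (suc n ∸ i) ≡ + 0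
    X-off zero          _ _   = refl
    X-off (suc zero)    _ 1≢1 = ⊥-elim (1≢1 refl)
    X-off (suc (suc i)) _ _   = refl

  X-⊛-cancel : ∀ {f g} → X ⊛ f ≈ X ⊛ g → f ≈ g
  X-⊛-cancel {f} {g} Xf≈Xg n = trans (sym (X-⊛-suc f n)) (trans (Xf≈Xg (suc n)) (X-⊛-suc g n))

  sumTo-X-⊛ : ∀ n (r Q : ℕ → ℤ) → r (suc n) ≡ + 0 →
    sumTo n (λ j → r j * (X ⊛ Q) j) ≡ sumTo n (λ j → r (suc j) * Q j)
  sumTo-X-⊛ n r Q r-end = begin
    sumTo n (λ j → r j * (X ⊛ Q) j)                       ≡⟨ sym (+-identityʳ _) ⟩
    sumTo n (λ j → r j * (X ⊛ Q) j) + + 0                 ≡⟨ cong (_+_ (sumTo n _)) (sym boundary) ⟩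
    sumTo n (λ j → r j * (X ⊛ Q) j) + r (suc n) * Q n     ≡⟨ with-boundary n ⟩
    sumTo n (λ j → r (suc j) * Q j)                       ∎
    where
    boundary : r (suc n) * Q n ≡ + 0
    boundary = trans (cong (_* Q n) r-end) (*-zeroˡ (Q n))
    with-boundary : ∀ m → sumTo m (λ j → r j * (X ⊛ Q) j) + r (suc m) * Q m ≡ sumTo m (λ j → r (suc j) * Q j)
    with-boundary zero    = trans (cong (_+ r 1 * Q 0) (*-zeroʳ (r 0))) (+-identityˡ _)
    with-boundary (suc m) =
      trans (cong (λ z → (sumTo m (λ j → r j * (X ⊛ Q) j) + r (suc m) * z) + r (suc (suc m)) * Q (suc m))
                  (X-⊛-suc Q m))
            (cong (_+ r (suc (suc m)) * Q (suc m)) (with-boundary m))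

  series-isCommutativeSemiring : IsCommutativeSemiring _≈_ _⊕_ _⊛_ zeroS one
  series-isCommutativeSemiring = record
    { isSemiring = record
      { isSemiringWithoutAnnihilatingZero = record
        { +-isCommutativeMonoid = record
          { isMonoid = record
            { isSemigroup = record
              { isMagma = record
                { isEquivalence = record { refl = ≈-refl ; sym = ≈-sym ; trans = ≈-trans }
                ; ∙-cong = ⊕-cong }
              ; assoc = λ f g h n → +-assoc (f n) (g n) (h n) }
            ; identity = (λ f n → +-identityˡ (f n)) , (λ f n → +-identityʳ (f n)) }
          ; comm = λ f g n → +-comm (f n) (g n) }
        ; *-cong = ⊛-cong
        ; *-assoc = ⊛-assoc
        ; *-identity = ⊛-identityˡ , ⊛-identityʳ
        ; distrib = ⊛-distribˡ-⊕ , ⊛-distribʳ-⊕ }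
      ; zero = ⊛-zeroˡ , ⊛-zeroʳ }
    ; *-comm = ⊛-comm }

  seriesRing : AlmostCommutativeRing _ _
  seriesRing = record
    { Carrier = Series ; _≈_ = _≈_ ; _+_ = _⊕_ ; _*_ = _⊛_ ; -_ = negS ; 0# = zeroS ; 1# = one
    ; isAlmostCommutativeRing = record
      { isCommutativeSemiring = series-isCommutativeSemiring
      ; -‿cong = λ f≈g n → cong -_ (f≈g n)
      ; -‿*-distribˡ = negS-⊛
      ; -‿+-comm = λ f g n → sym (neg-distrib-+ (f n) (g n)) } }

  ℤ-rawRing : RawRing _ _
  ℤ-rawRing = CommutativeRing.rawRing +-*-commutativeRing

  κ-homomorphism : ℤ-rawRing -Raw-AlmostCommutative⟶ seriesRing
  κ-homomorphism = record
    { ⟦_⟧    = κ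
    ; +-homo = λ a b → λ { zero → refl ; (suc n) → refl }
    ; *-homo = λ a b n → sym (trans (κ-⊛ a (κ b) n) (κ-scale a b n))
    ; -‿homo = λ a → λ { zero → refl ; (suc n) → refl }
    ; 0-homo = λ { zero → refl ; (suc n) → refl }
    ; 1-homo = λ { zero → refl ; (suc n) → refl } }
    where
    κ-scale : ∀ a b n → a * κ b n ≡ κ (a * b) n
    κ-scale a b zero    = refl
    κ-scale a b (suc n) = *-zeroʳ a

  κ-≟ : WeaklyDecidable (Induced-equivalence κ-homomorphism)
  κ-≟ a b with a ≟ b
  ... | yes a≡b = just (λ n → cong (λ z → κ z n) a≡b)
  ... | no  _   = nothing

  module SeriesSolver = Algebra.Solver.Ring ℤ-rawRing seriesRing κ-homomorphism κ-≟

  OrderAtLeast : ℕ → Series → Set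
  OrderAtLeast a f = ∀ j → j < a → f j ≡ + 0

  DegreeAtMost : ℕ → Series → Set
  DegreeAtMost a f = ∀ j → a < j → f j ≡ + 0

  ⊛-order : ∀ {a b f g} → OrderAtLeast a f → OrderAtLeast b g → OrderAtLeast (a ℕ.+ b) (f ⊛ g)
  ⊛-order {a} {b} {f} {g} ord-f ord-g n n<a+b = sumTo-zero n term-zero
    where
    term-zero : ∀ i → i ≤ n → f i * g (n ∸ i) ≡ + 0
    term-zero i i≤n with i ℕ.<? a
    ... | yes i<a = trans (cong (_* g (n ∸ i)) (ord-f i i<a)) (*-zeroˡ (g (n ∸ i)))
    ... | no  i≮a = trans (cong (f i *_) (ord-g (n ∸ i) n∸i<b)) (*-zeroʳ (f i))
      where
      n<i+b = ℕ.<-≤-trans n<a+b (ℕ.+-monoˡ-≤ b (ℕ.≮⇒≥ i≮a))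
      n∸i<b = subst (n ∸ i <_) (ℕ.m+n∸m≡n i b) (ℕ.∸-monoˡ-< n<i+b i≤n)

  ⊛-degree : ∀ {a b f g} → DegreeAtMost a f → DegreeAtMost b g → DegreeAtMost (a ℕ.+ b) (f ⊛ g)
  ⊛-degree {a} {b} {f} {g} deg-f deg-g n a+b<n = sumTo-zero n term-zero
    where
    term-zero : ∀ i → i ≤ n → f i * g (n ∸ i) ≡ + 0
    term-zero i i≤n with a ℕ.<? i
    ... | yes a<i = trans (cong (_* g (n ∸ i)) (deg-f i a<i)) (*-zeroˡ (g (n ∸ i)))
    ... | no  a≮i = trans (cong (f i *_) (deg-g (n ∸ i) b<n∸i)) (*-zeroʳ (f i))
      where
      i+b<n = ℕ.≤-<-trans (ℕ.+-monoˡ-≤ b (ℕ.≮⇒≥ a≮i)) a+b<n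
      b<n∸i = subst (_< n ∸ i) (ℕ.m+n∸m≡n i b) (ℕ.∸-monoˡ-< i+b<n (ℕ.m≤m+n i b))

  pow-order : ∀ {h} → h 0 ≡ + 0 → ∀ k → OrderAtLeast k (pow h k)
  pow-order h0 zero    j ()
  pow-order {h} h0 (suc k) = ⊛-order {1} {k} {h} (λ { zero _ → h0 ; (suc j) (s≤s ()) }) (pow-order h0 k)

  pow-diagonal : ∀ {h} → h 0 ≡ + 0 → ∀ k → pow h k k ≡ h 1 ^ k
  pow-diagonal h0 zero = refl
  pow-diagonal {h} h0 (suc k) =
    trans (sumTo-single (suc k) (s≤s z≤n) off-diagonal) (cong (h 1 *_) (pow-diagonal h0 k))
    where
    off-diagonal : ∀ i → i ≤ suc k → i ≢ 1 → h i * pow h k (suc k ∸ i) ≡ + 0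
    off-diagonal zero          _           _   = cong (_* pow h k (suc k)) h0
    off-diagonal (suc zero)    _           1≢1 = ⊥-elim (1≢1 refl)
    off-diagonal (suc (suc i)) (s≤s i<k) _   =
      trans (cong (h (suc (suc i)) *_) (pow-order h0 k (k ∸ suc i) (ℕ.∸-monoʳ-< (s≤s z≤n) i<k)))
            (*-zeroʳ (h (suc (suc i))))

  euler : Series → Series
  euler f n = + n * f n

  euler≈X⊛deriv : ∀ f → euler f ≈ X ⊛ deriv f
  euler≈X⊛deriv f zero    = refl
  euler≈X⊛deriv f (suc n) = sym (X-⊛-suc (deriv f) n)

  euler-⊛ : ∀ f g → euler (f ⊛ g) ≈ (euler f ⊛ g) ⊕ (f ⊛ euler g)
  euler-⊛ f g n = begin
    + n * sumTo n (λ i → f i * g (n ∸ i))             ≡⟨ *-distribˡ-sumTo n (+ n) _ ⟩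
    sumTo n (λ i → + n * (f i * g (n ∸ i)))           ≡⟨ sumTo-cong-≤ n split-weight ⟩
    sumTo n (λ i → + i * f i * g (n ∸ i) + f i * (+ (n ∸ i) * g (n ∸ i)))
                                                      ≡⟨ sumTo-distrib-+ n _ _ ⟩
    ((euler f ⊛ g) ⊕ (f ⊛ euler g)) n                 ∎
    where
    split-weight : ∀ i → i ≤ n →
      + n * (f i * g (n ∸ i)) ≡ + i * f i * g (n ∸ i) + f i * (+ (n ∸ i) * g (n ∸ i))
    split-weight i i≤n = begin
      + n * (f i * g (n ∸ i))                  ≡⟨ cong (λ m → + m * (f i * g (n ∸ i))) (sym (ℕ.m+[n∸m]≡n i≤n)) ⟩
      + (i ℕ.+ (n ∸ i)) * (f i * g (n ∸ i))    ≡⟨ cong (_* (f i * g (n ∸ i))) (pos-+ i (n ∸ i)) ⟩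
      (+ i + + (n ∸ i)) * (f i * g (n ∸ i))    ≡⟨ distribute (+ i) (+ (n ∸ i)) (f i) (g (n ∸ i)) ⟩
      + i * f i * g (n ∸ i) + f i * (+ (n ∸ i) * g (n ∸ i)) ∎
      where
      distribute : ∀ a b x y → (a + b) * (x * y) ≡ a * x * y + x * (b * y)
      distribute = solve-∀

  deriv-cong-suc : ∀ {f g} → (∀ n → f (suc n) ≡ g (suc n)) → deriv f ≈ deriv g
  deriv-cong-suc f≡g n = cong (+ suc n *_) (f≡g n)

  deriv-X : deriv X ≈ one
  deriv-X zero    = refl
  deriv-X (suc n) = *-zeroʳ (+ suc (suc n))

  -- Leibniz rule, obtained from the one for euler = t · d/dt by cancelling t.
  deriv-⊛ : ∀ f g → deriv (f ⊛ g) ≈ (deriv f ⊛ g) ⊕ (f ⊛ deriv g)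
  deriv-⊛ f g = X-⊛-cancel λ n → begin
    (X ⊛ deriv (f ⊛ g)) n                           ≡⟨ sym (euler≈X⊛deriv (f ⊛ g) n) ⟩
    euler (f ⊛ g) n                                 ≡⟨ euler-⊛ f g n ⟩
    ((euler f ⊛ g) ⊕ (f ⊛ euler g)) n               ≡⟨ ⊕-cong (⊛-cong {g = g} (euler≈X⊛deriv f) ≈-refl)
                                                              (⊛-cong {f} ≈-refl (euler≈X⊛deriv g)) n ⟩
    (((X ⊛ deriv f) ⊛ g) ⊕ (f ⊛ (X ⊛ deriv g))) n   ≡⟨ factor-X n ⟩
    (X ⊛ ((deriv f ⊛ g) ⊕ (f ⊛ deriv g))) n         ∎
    where
    open SeriesSolver
    factor-X : ((X ⊛ deriv f) ⊛ g) ⊕ (f ⊛ (X ⊛ deriv g)) ≈ X ⊛ ((deriv f ⊛ g) ⊕ (f ⊛ deriv g))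
    factor-X = solve 5 (λ t f f′ g g′ → (t :* f′) :* g :+ f :* (t :* g′) := t :* (f′ :* g :+ f :* g′))
                     ≈-refl X f (deriv f) g (deriv g)

  -- Lower triangular matrices

  LowerTriangular : Matrix → Set
  LowerTriangular M = ∀ {n k} → n < k → M n k ≡ + 0

  riordan-lowerTriangular : ∀ d {h} → h 0 ≡ + 0 → LowerTriangular (riordan d h)
  riordan-lowerTriangular d {h} h0 {n} {k} = ⊛-order {0} {k} {d} (λ _ ()) (pow-order h0 k) n

  riordan-diagonal : ∀ d {h} → h 0 ≡ + 0 → ∀ k → riordan d h k k ≡ d 0 * h 1 ^ k
  riordan-diagonal d {h} h0 k =
    trans (sumTo-single k z≤n off-diagonal) (cong (d 0 *_) (pow-diagonal h0 k))
    where
    off-diagonal : ∀ i → i ≤ k → i ≢ 0 → d i * pow h k (k ∸ i) ≡ + 0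
    off-diagonal zero    _   0≢0 = ⊥-elim (0≢0 refl)
    off-diagonal (suc i) i<k _   =
      trans (cong (d (suc i) *_) (pow-order h0 k (k ∸ suc i) (ℕ.∸-monoʳ-< (s≤s z≤n) i<k)))
            (*-zeroʳ (d (suc i)))

  idM-lowerTriangular : LowerTriangular idM
  idM-lowerTriangular {zero}  {suc k} _         = refl
  idM-lowerTriangular {suc n} {suc k} (s≤s n<k) = idM-lowerTriangular n<k

  idM-diagonal : ∀ n → idM n n ≡ + 1
  idM-diagonal zero    = refl
  idM-diagonal (suc n) = idM-diagonal n

  idM-off-diagonal : ∀ {n k} → n ≢ k → idM n k ≡ + 0
  idM-off-diagonal {zero}  {zero}  0≢0   = ⊥-elim (0≢0 refl)
  idM-off-diagonal {zero}  {suc k} _     = refl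
  idM-off-diagonal {suc n} {zero}  _     = refl
  idM-off-diagonal {suc n} {suc k} n+1≢k+1 = idM-off-diagonal (n+1≢k+1 ∘ cong suc)

  ⊠-identityˡ : ∀ A n k → (idM ⊠ A) n k ≡ A n k
  ⊠-identityˡ A n k = begin
    sumTo n (λ j → idM n j * A j k) ≡⟨ sumTo-single n ℕ.≤-refl off-diagonal ⟩
    idM n n * A n k                 ≡⟨ cong (_* A n k) (idM-diagonal n) ⟩
    + 1 * A n k                     ≡⟨ *-identityˡ (A n k) ⟩
    A n k                           ∎
    where
    off-diagonal : ∀ j → j ≤ n → j ≢ n → idM n j * A j k ≡ + 0
    off-diagonal j _ j≢n = cong (_* A j k) (idM-off-diagonal (j≢n ∘ sym))

  ⊠-identityʳ : ∀ {A} → LowerTriangular A → ∀ n k → (A ⊠ idM) n k ≡ A n k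
  ⊠-identityʳ {A} lower-A n k with k ℕ.≤? n
  ... | yes k≤n = begin
    sumTo n (λ j → A n j * idM j k) ≡⟨ sumTo-single n k≤n off-diagonal ⟩
    A n k * idM k k                 ≡⟨ cong (A n k *_) (idM-diagonal k) ⟩
    A n k * + 1                     ≡⟨ *-identityʳ (A n k) ⟩
    A n k                           ∎
    where
    off-diagonal : ∀ j → j ≤ n → j ≢ k → A n j * idM j k ≡ + 0
    off-diagonal j _ j≢k = trans (cong (A n j *_) (idM-off-diagonal j≢k)) (*-zeroʳ (A n j))
  ... | no k≰n = trans (sumTo-zero n above-diagonal) (sym (lower-A (ℕ.≰⇒> k≰n)))
    where
    above-diagonal : ∀ j → j ≤ n → A n j * idM j k ≡ + 0
    above-diagonal j j≤n =
      trans (cong (A n j *_) (idM-lowerTriangular (ℕ.≤-<-trans j≤n (ℕ.≰⇒> k≰n)))) (*-zeroʳ (A n j))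

  ⊠-lowerTriangular : ∀ {A B} → LowerTriangular B → LowerTriangular (A ⊠ B)
  ⊠-lowerTriangular {A} {B} lower-B {n} {k} n<k = sumTo-zero n λ j j≤n →
    trans (cong (A n j *_) (lower-B (ℕ.≤-<-trans j≤n n<k))) (*-zeroʳ (A n j))

  ⊠-assoc : ∀ {A B C} → LowerTriangular B → ∀ n k → ((A ⊠ B) ⊠ C) n k ≡ (A ⊠ (B ⊠ C)) n k
  ⊠-assoc {A} {B} {C} lower-B n k = begin
    sumTo n (λ i → sumTo n (λ j → A n j * B j i) * C i k)
      ≡⟨ sumTo-cong n (λ i → *-distribʳ-sumTo n (C i k) (λ j → A n j * B j i)) ⟩
    sumTo n (λ i → sumTo n (λ j → A n j * B j i * C i k))
      ≡⟨ sumTo-swap n n (λ i j → A n j * B j i * C i k) ⟩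
    sumTo n (λ j → sumTo n (λ i → A n j * B j i * C i k))
      ≡⟨ sumTo-cong n (λ j → trans (sumTo-cong n (λ i → *-assoc (A n j) (B j i) (C i k)))
                                   (sym (*-distribˡ-sumTo n (A n j) (λ i → B j i * C i k)))) ⟩
    sumTo n (λ j → A n j * sumTo n (λ i → B j i * C i k))
      ≡⟨ sumTo-cong-≤ n (λ j j≤n → cong (A n j *_) (sumTo-truncate n j≤n (above-row j))) ⟩
    sumTo n (λ j → A n j * sumTo j (λ i → B j i * C i k)) ∎
    where
    above-row : ∀ j i → j < i → B j i * C i k ≡ + 0
    above-row j i j<i = trans (cong (_* C i k) (lower-B j<i)) (*-zeroˡ (C i k))

  UnitDiagonal : Matrix → Set
  UnitDiagonal N = ∀ k → N k k ≡ + 1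

  ⊠-cancelʳ : ∀ {A B N} → LowerTriangular A → LowerTriangular B → LowerTriangular N → UnitDiagonal N →
    (∀ n k → (A ⊠ N) n k ≡ (B ⊠ N) n k) → ∀ n k → A n k ≡ B n k
  ⊠-cancelʳ {A} {B} {N} lower-A lower-B lower-N unit-N AN≡BN n k =
    i-j≡0⇒i≡j (A n k) (B n k) (below-diagonal n k n (ℕ.m≤n+m n k))
    where
    E : Matrix
    E n k = A n k - B n k

    lower-E : LowerTriangular E
    lower-E n<k = cong₂ _-_ (lower-A n<k) (lower-B n<k)

    EN≡0 : ∀ n k → (E ⊠ N) n k ≡ + 0
    EN≡0 n k = begin
      sumTo n (λ j → (A n j - B n j) * N j k)
        ≡⟨ sumTo-cong n (λ j → *-distribʳ-- (A n j) (B n j) (N j k)) ⟩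
      sumTo n (λ j → A n j * N j k - B n j * N j k)
        ≡⟨ sumTo-distrib-- n _ _ ⟩
      (A ⊠ N) n k - (B ⊠ N) n k
        ≡⟨ i≡j⇒i-j≡0 (AN≡BN n k) ⟩
      + 0 ∎
      where
      *-distribʳ-- : ∀ a b c → (a - b) * c ≡ a * c - b * c
      *-distribʳ-- = solve-∀

    -- Row n of E ⊠ N, read at column k, isolates E n k once the entries right of k vanish.
    column-step : ∀ {n} k → (∀ j → k < j → E n j ≡ + 0) → E n k ≡ + 0
    column-step {n} k right-zero with k ℕ.≤? n
    ... | no  k≰n = lower-E (ℕ.≰⇒> k≰n)
    ... | yes k≤n = begin
      E n k                           ≡⟨ sym (*-identityʳ (E n k)) ⟩
      E n k * + 1                     ≡⟨ cong (E n k *_) (sym (unit-N k)) ⟩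
      E n k * N k k                   ≡⟨ sym (sumTo-single n k≤n off-diagonal) ⟩
      sumTo n (λ j → E n j * N j k)   ≡⟨ EN≡0 n k ⟩
      + 0                             ∎
      where
      off-diagonal : ∀ j → j ≤ n → j ≢ k → E n j * N j k ≡ + 0
      off-diagonal j _ j≢k with ℕ.<-cmp j k
      ... | tri< j<k _ _ = trans (cong (E n j *_) (lower-N j<k)) (*-zeroʳ (E n j))
      ... | tri≈ _ j≡k _ = ⊥-elim (j≢k j≡k)
      ... | tri> _ _ k<j = trans (cong (_* N j k) (right-zero j k<j)) (*-zeroˡ (N j k))

    below-diagonal : ∀ n k m → n ≤ k ℕ.+ m → E n k ≡ + 0
    below-diagonal n k zero    n≤k+0 = column-step k λ j k<j →
      lower-E (ℕ.≤-<-trans (subst (n ≤_) (ℕ.+-identityʳ k) n≤k+0) k<j)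
    below-diagonal n k (suc m) n≤k+1+m = column-step k λ j k<j →
      below-diagonal n j m (ℕ.≤-trans (subst (n ≤_) (ℕ.+-suc k m) n≤k+1+m) (ℕ.+-monoˡ-≤ m k<j))

  rightInverse⇒isInverse : ∀ {M N} → LowerTriangular M → LowerTriangular N → UnitDiagonal N →
    (∀ n k → (M ⊠ N) n k ≡ idM n k) → IsInverse M N
  rightInverse⇒isInverse {M} {N} lower-M lower-N unit-N MN≡I = MN≡I , NM≡I
    where
    NMN≡IN : ∀ n k → ((N ⊠ M) ⊠ N) n k ≡ (idM ⊠ N) n k
    NMN≡IN n k = begin
      ((N ⊠ M) ⊠ N) n k   ≡⟨ ⊠-assoc {N} {M} {N} lower-M n k ⟩
      (N ⊠ (M ⊠ N)) n k   ≡⟨ sumTo-cong n (λ j → cong (N n j *_) (MN≡I j k)) ⟩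
      (N ⊠ idM) n k       ≡⟨ ⊠-identityʳ {N} lower-N n k ⟩
      N n k               ≡⟨ sym (⊠-identityˡ N n k) ⟩
      (idM ⊠ N) n k       ∎

    NM≡I : ∀ n k → (N ⊠ M) n k ≡ idM n k
    NM≡I = ⊠-cancelʳ (⊠-lowerTriangular {N} lower-M) idM-lowerTriangular lower-N unit-N NMN≡IN

  -- The array R((1 - t)² (1 - 2t), t - t²) and its left inverses

  invD invH : Series
  invD = (one ⊖ X) ⊛ ((one ⊖ X) ⊛ (one ⊖ (X ⊕ X)))
  invH = X ⊖ (X ⊛ X)

  invDerSha : Matrix
  invDerSha = riordan invD invH

  invD-degree : DegreeAtMost 3 invD
  invD-degree = ⊛-degree {1} {2} {one ⊖ X} linear (⊛-degree {1} {1} {one ⊖ X} linear linear′)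
    where
    linear : DegreeAtMost 1 (one ⊖ X)
    linear (suc zero)    (s≤s ())
    linear (suc (suc j)) _ = refl
    linear′ : DegreeAtMost 1 (one ⊖ (X ⊕ X))
    linear′ (suc zero)    (s≤s ())
    linear′ (suc (suc j)) _ = refl

  invDerSha-lowerTriangular : LowerTriangular invDerSha
  invDerSha-lowerTriangular = riordan-lowerTriangular invD refl

  invDerSha-unitDiagonal : UnitDiagonal invDerSha
  invDerSha-unitDiagonal k = trans (riordan-diagonal invD refl k) (trans (*-identityˡ _) (^-zeroˡ k))

  invDerSha-column₀ : ∀ j → invDerSha j 0 ≡ invD j
  invDerSha-column₀ = ⊛-identityʳ invD

  invDerSha-shift : ∀ j k →
    invDerSha j (suc k) ≡ (X ⊛ (λ i → invDerSha i k)) j - (X ⊛ (X ⊛ (λ i → invDerSha i k))) j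
  invDerSha-shift j k =
    solve 3 (λ t d p → d :* ((t :- t :* t) :* p) := t :* (d :* p) :- t :* (t :* (d :* p)))
          ≈-refl X invD (pow invH k) j
    where open SeriesSolver

  -- For A = R(d, h), the shift relation says h = t + h², and the column-0 relation says
  -- d (1 - h)² (1 - 2h) = 1, i.e. d (1 - 4h + 5h² - 2h³) = 1.
  record DerShaRecurrences (A : Matrix) : Set where
    field
      lowerTriangular : LowerTriangular A
      shift           : ∀ n k → A (suc n) (suc k) ≡ A n k + A (suc n) (suc (suc k))
      column₀         : ∀ n → A n 0 - + 4 * A n 1 + + 5 * A n 2 - + 2 * A n 3 ≡ one n

  module _ {A : Matrix} (rec : DerShaRecurrences A) where
    open DerShaRecurrences rec

    ⊠-invDerSha-suc : ∀ n k → (A ⊠ invDerSha) (suc n) (suc k) ≡ (A ⊠ invDerSha) n k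
    ⊠-invDerSha-suc n k = begin
      sumTo (suc n) (λ j → r j * invDerSha j (suc k))
        ≡⟨ sumTo-cong (suc n) (λ j → trans (cong (r j *_) (invDerSha-shift j k)) (*-distribˡ-- (r j) _ _)) ⟩
      sumTo (suc n) (λ j → r j * (X ⊛ Q) j - r j * (X ⊛ (X ⊛ Q)) j)
        ≡⟨ sumTo-distrib-- (suc n) _ _ ⟩
      sumTo (suc n) (λ j → r j * (X ⊛ Q) j) - sumTo (suc n) (λ j → r j * (X ⊛ (X ⊛ Q)) j)
        ≡⟨ cong₂ _-_ (sumTo-X-⊛ (suc n) r Q (r-end 0))
                     (trans (sumTo-X-⊛ (suc n) r (X ⊛ Q) (r-end 0)) (sumTo-X-⊛ (suc n) (r ∘ suc) Q (r-end 1))) ⟩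
      sumTo (suc n) (λ j → r (suc j) * Q j) - sumTo (suc n) (λ j → r (suc (suc j)) * Q j)
        ≡⟨ sym (sumTo-distrib-- (suc n) _ _) ⟩
      sumTo (suc n) (λ j → r (suc j) * Q j - r (suc (suc j)) * Q j)
        ≡⟨ sumTo-cong (suc n) previous-row ⟩
      sumTo (suc n) (λ j → A n j * Q j)
        ≡⟨ sumTo-truncate (suc n) (ℕ.n≤1+n n) (λ j n<j → trans (cong (_* Q j) (lowerTriangular n<j)) (*-zeroˡ (Q j))) ⟩
      sumTo n (λ j → A n j * Q j) ∎
      where
      r Q : ℕ → ℤ
      r     = A (suc n)
      Q j   = invDerSha j k
      r-end : ∀ i → r (suc (i ℕ.+ suc n)) ≡ + 0
      r-end i = lowerTriangular (s≤s (ℕ.m≤n+m (suc n) i))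
      *-distribˡ-- : ∀ a b c → a * (b - c) ≡ a * b - a * c
      *-distribˡ-- = solve-∀
      previous-row : ∀ j → r (suc j) * Q j - r (suc (suc j)) * Q j ≡ A n j * Q j
      previous-row j = trans (cong (λ z → z * Q j - r (suc (suc j)) * Q j) (shift n j))
                             (cancel (A n j) (r (suc (suc j))) (Q j))
        where
        cancel : ∀ a b q → (a + b) * q - b * q ≡ a * q
        cancel = solve-∀

    ⊠-invDerSha-column₀ : ∀ n → (A ⊠ invDerSha) n 0 ≡ one n
    ⊠-invDerSha-column₀ n = begin
      sumTo n (λ j → A n j * invDerSha j 0)   ≡⟨ sumTo-cong n (λ j → cong (A n j *_) (invDerSha-column₀ j)) ⟩
      sumTo n F                              ≡⟨ sym (sumTo-truncate (n ℕ.+ 3) (ℕ.m≤m+n n 3) beyond-row) ⟩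
      sumTo (n ℕ.+ 3) F                      ≡⟨ sumTo-truncate (n ℕ.+ 3) (ℕ.m≤n+m 3 n) beyond-degree ⟩
      F 0 + F 1 + F 2 + F 3                  ≡⟨ expand (A n 0) (A n 1) (A n 2) (A n 3) ⟩
      A n 0 - + 4 * A n 1 + + 5 * A n 2 - + 2 * A n 3 ≡⟨ column₀ n ⟩
      one n                                  ∎
      where
      F : ℕ → ℤ
      F j = A n j * invD j
      beyond-row : ∀ j → n < j → F j ≡ + 0
      beyond-row j n<j = trans (cong (_* invD j) (lowerTriangular n<j)) (*-zeroˡ (invD j))
      beyond-degree : ∀ j → 3 < j → F j ≡ + 0
      beyond-degree j 3<j = trans (cong (A n j *_) (invD-degree j 3<j)) (*-zeroʳ (A n j))
      expand : ∀ a b c d → a * + 1 + b * - + 4 + c * + 5 + d * - + 2 ≡ a - + 4 * b + + 5 * c - + 2 * d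
      expand = solve-∀

    derShaRecurrences⇒⊠-invDerSha : ∀ n k → (A ⊠ invDerSha) n k ≡ idM n k
    derShaRecurrences⇒⊠-invDerSha zero    zero    = ⊠-invDerSha-column₀ 0
    derShaRecurrences⇒⊠-invDerSha (suc n) zero    = ⊠-invDerSha-column₀ (suc n)
    derShaRecurrences⇒⊠-invDerSha zero    (suc k) =
      trans (cong (A 0 0 *_) (invDerSha-lowerTriangular {0} {suc k} (s≤s z≤n))) (*-zeroʳ (A 0 0))
    derShaRecurrences⇒⊠-invDerSha (suc n) (suc k) =
      trans (⊠-invDerSha-suc n k) (derShaRecurrences⇒⊠-invDerSha n k)

  -- The entry (2n-k+2 choose n-k) written as (2n+2-k choose n+2), which vanishes for k > n.
  binomialArray : Matrix
  binomialArray n k = + ((2 ℕ.+ 2 ℕ.* n ∸ k) C (2 ℕ.+ n))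

  pascal : ∀ r s → suc r C suc s ≡ r C s ℕ.+ r C suc s
  pascal r s = sym (nCk+nC[k+1]≡[n+1]C[k+1] r s)

  pascal-∸ : ∀ m k r → (suc m ∸ k) C suc (suc r) ≡ (m ∸ k) C suc r ℕ.+ (m ∸ k) C suc (suc r)
  pascal-∸ m       zero    r = pascal m (suc r)
  pascal-∸ zero    (suc k) r rewrite ℕ.0∸n≡0 k = refl
  pascal-∸ (suc m) (suc k) r = pascal-∸ m k r

  middle-symmetry : ∀ m → (1 ℕ.+ 2 ℕ.* m) C m ≡ (1 ℕ.+ 2 ℕ.* m) C (1 ℕ.+ m)
  middle-symmetry m = trans (nCk≡nC[n∸k] m≤M) (cong ((1 ℕ.+ 2 ℕ.* m) C_) M∸m≡1+m)
    where
    M≡m+1+m : ∀ m → 1 ℕ.+ 2 ℕ.* m ≡ m ℕ.+ (1 ℕ.+ m)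
    M≡m+1+m = ℕ-solve-∀
    m≤M : m ≤ 1 ℕ.+ 2 ℕ.* m
    m≤M = subst (m ≤_) (sym (M≡m+1+m m)) (ℕ.m≤m+n m (1 ℕ.+ m))
    M∸m≡1+m : 1 ℕ.+ 2 ℕ.* m ∸ m ≡ 1 ℕ.+ m
    M∸m≡1+m = trans (cong (_∸ m) (M≡m+1+m m)) (ℕ.m+n∸m≡n m (1 ℕ.+ m))

  -- Expanding every binomial by Pascal down to row M = 2m+1, where (M choose m) = (M choose m+1).
  binomial-column₀ : ∀ m → let M = 1 ℕ.+ 2 ℕ.* m in
    (3 ℕ.+ M) C (3 ℕ.+ m) ℕ.+ 5 ℕ.* ((1 ℕ.+ M) C (3 ℕ.+ m))
      ≡ 4 ℕ.* ((2 ℕ.+ M) C (3 ℕ.+ m)) ℕ.+ 2 ℕ.* (M C (3 ℕ.+ m))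
  binomial-column₀ m
    rewrite pascal (2 ℕ.+ (1 ℕ.+ 2 ℕ.* m)) (2 ℕ.+ m) | pascal (1 ℕ.+ (1 ℕ.+ 2 ℕ.* m)) (2 ℕ.+ m)
          | pascal (1 ℕ.+ (1 ℕ.+ 2 ℕ.* m)) (1 ℕ.+ m)  | pascal (1 ℕ.+ 2 ℕ.* m) m
          | pascal (1 ℕ.+ 2 ℕ.* m) (1 ℕ.+ m)          | pascal (1 ℕ.+ 2 ℕ.* m) (2 ℕ.+ m)
          | middle-symmetry m
    = collect ((1 ℕ.+ 2 ℕ.* m) C (1 ℕ.+ m)) ((1 ℕ.+ 2 ℕ.* m) C (2 ℕ.+ m)) ((1 ℕ.+ 2 ℕ.* m) C (3 ℕ.+ m))
    where
    collect : ∀ a b d → a ℕ.+ a ℕ.+ (a ℕ.+ b) ℕ.+ (a ℕ.+ b ℕ.+ (b ℕ.+ d)) ℕ.+ 5 ℕ.* (b ℕ.+ d)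
                          ≡ 4 ℕ.* (a ℕ.+ b ℕ.+ (b ℕ.+ d)) ℕ.+ 2 ℕ.* d
    collect = ℕ-solve-∀

  binomialArray-column₀ : ∀ m → let T = 2 ℕ.+ 2 ℕ.* suc m in
    T C (3 ℕ.+ m) ℕ.+ 5 ℕ.* ((T ∸ 2) C (3 ℕ.+ m)) ≡ 4 ℕ.* ((T ∸ 1) C (3 ℕ.+ m)) ℕ.+ 2 ℕ.* ((T ∸ 3) C (3 ℕ.+ m))
  binomialArray-column₀ m = subst P (sym (ℕ.*-suc 2 m)) (binomial-column₀ m)
    where
    P : ℕ → Set
    P t = (2 ℕ.+ t) C (3 ℕ.+ m) ℕ.+ 5 ℕ.* ((2 ℕ.+ t ∸ 2) C (3 ℕ.+ m))
            ≡ 4 ℕ.* ((2 ℕ.+ t ∸ 1) C (3 ℕ.+ m)) ℕ.+ 2 ℕ.* ((2 ℕ.+ t ∸ 3) C (3 ℕ.+ m))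

  binomial-shift : ∀ n k → (2 ℕ.+ 2 ℕ.* suc n ∸ suc k) C (3 ℕ.+ n)
    ≡ (2 ℕ.+ 2 ℕ.* n ∸ k) C (2 ℕ.+ n) ℕ.+ (2 ℕ.+ 2 ℕ.* suc n ∸ suc (suc k)) C (3 ℕ.+ n)
  binomial-shift n k rewrite ℕ.*-suc 2 n = pascal-∸ (2 ℕ.+ 2 ℕ.* n) k (suc n)

  binomialArray-recurrences : DerShaRecurrences binomialArray
  binomialArray-recurrences = record
    { lowerTriangular = lower
    ; shift           = shift
    ; column₀         = column₀ }
    where
    lower : LowerTriangular binomialArray
    lower {n} {k} n<k = cong +_ (k>n⇒nCk≡0 top<2+n)
      where
      2+2n∸1+n : 2 ℕ.+ 2 ℕ.* n ∸ suc n ≡ suc n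
      2+2n∸1+n = trans (cong (_∸ suc n) (two-n n)) (ℕ.m+n∸m≡n (suc n) (suc n))
        where
        two-n : ∀ n → 2 ℕ.+ 2 ℕ.* n ≡ suc n ℕ.+ suc n
        two-n = ℕ-solve-∀
      top<2+n : 2 ℕ.+ 2 ℕ.* n ∸ k < 2 ℕ.+ n
      top<2+n = s≤s (subst (2 ℕ.+ 2 ℕ.* n ∸ k ≤_) 2+2n∸1+n (ℕ.∸-monoʳ-≤ (2 ℕ.+ 2 ℕ.* n) n<k))

    shift : ∀ n k → binomialArray (suc n) (suc k) ≡ binomialArray n k + binomialArray (suc n) (suc (suc k))
    shift n k = trans (cong +_ (binomial-shift n k))
                      (pos-+ ((2 ℕ.+ 2 ℕ.* n ∸ k) C (2 ℕ.+ n)) ((2 ℕ.+ 2 ℕ.* suc n ∸ suc (suc k)) C (3 ℕ.+ n)))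

    column₀ : ∀ n → binomialArray n 0 - + 4 * binomialArray n 1 + + 5 * binomialArray n 2
                      - + 2 * binomialArray n 3 ≡ one n
    column₀ zero    = refl
    column₀ (suc m) = balanced (T C (3 ℕ.+ m)) ((T ∸ 1) C (3 ℕ.+ m)) ((T ∸ 2) C (3 ℕ.+ m)) ((T ∸ 3) C (3 ℕ.+ m))
                               (binomialArray-column₀ m)
      where
      T = 2 ℕ.+ 2 ℕ.* suc m
      balanced : ∀ a b c d → a ℕ.+ 5 ℕ.* c ≡ 4 ℕ.* b ℕ.+ 2 ℕ.* d →
        + a - + 4 * + b + + 5 * + c - + 2 * + d ≡ + 0
      balanced a b c d a+5c≡4b+2d = begin
        + a - + 4 * + b + + 5 * + c - + 2 * + d    ≡⟨ regroup (+ a) (+ b) (+ c) (+ d) ⟩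
        (+ a + + 5 * + c) - (+ 4 * + b + + 2 * + d) ≡⟨ cong₂ _-_ (sym pos-a+5c) (sym pos-4b+2d) ⟩
        + (a ℕ.+ 5 ℕ.* c) - + (4 ℕ.* b ℕ.+ 2 ℕ.* d) ≡⟨ i≡j⇒i-j≡0 (cong +_ a+5c≡4b+2d) ⟩
        + 0 ∎
        where
        regroup : ∀ x y z w → x - + 4 * y + + 5 * z - + 2 * w ≡ (x + + 5 * z) - (+ 4 * y + + 2 * w)
        regroup = solve-∀
        pos-a+5c : + (a ℕ.+ 5 ℕ.* c) ≡ + a + + 5 * + c
        pos-a+5c = trans (pos-+ a (5 ℕ.* c)) (cong (_+_ (+ a)) (pos-* 5 c))
        pos-4b+2d : + (4 ℕ.* b ℕ.+ 2 ℕ.* d) ≡ + 4 * + b + + 2 * + d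
        pos-4b+2d = trans (pos-+ (4 ℕ.* b) (2 ℕ.* d)) (cong₂ _+_ (pos-* 4 b) (pos-* 2 d))

  binomialArray-entry : ∀ {n k} → k ≤ n → binomialArray n k ≡ + ((2 ℕ.* n ∸ k ℕ.+ 2) C (n ∸ k))
  binomialArray-entry {n} {k} k≤n =
    cong +_ (subst (λ n → (2 ℕ.+ 2 ℕ.* n ∸ k) C (2 ℕ.+ n) ≡ (2 ℕ.* n ∸ k ℕ.+ 2) C (n ∸ k))
                   (ℕ.m+[n∸m]≡n k≤n) (symmetric k (n ∸ k)))
    where
    symmetric : ∀ k d → (2 ℕ.+ 2 ℕ.* (k ℕ.+ d) ∸ k) C (2 ℕ.+ (k ℕ.+ d))
                          ≡ (2 ℕ.* (k ℕ.+ d) ∸ k ℕ.+ 2) C (k ℕ.+ d ∸ k)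
    symmetric k d = begin
      (2 ℕ.+ 2 ℕ.* (k ℕ.+ d) ∸ k) C a   ≡⟨ cong (λ t → (t ∸ k) C a) (left-top k d) ⟩
      (k ℕ.+ (a ℕ.+ d) ∸ k) C a        ≡⟨ cong (_C a) (ℕ.m+n∸m≡n k (a ℕ.+ d)) ⟩
      (a ℕ.+ d) C a                    ≡⟨ nCk≡nC[n∸k] (ℕ.m≤m+n a d) ⟩
      (a ℕ.+ d) C (a ℕ.+ d ∸ a)        ≡⟨ cong₂ _C_ (sym right-top) (trans (ℕ.m+n∸m≡n a d) (sym (ℕ.m+n∸m≡n k d))) ⟩
      (2 ℕ.* (k ℕ.+ d) ∸ k ℕ.+ 2) C (k ℕ.+ d ∸ k) ∎
      where
      a = 2 ℕ.+ (k ℕ.+ d)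
      left-top : ∀ k d → 2 ℕ.+ 2 ℕ.* (k ℕ.+ d) ≡ k ℕ.+ ((2 ℕ.+ (k ℕ.+ d)) ℕ.+ d)
      left-top = ℕ-solve-∀
      double : ∀ k d → 2 ℕ.* (k ℕ.+ d) ≡ k ℕ.+ (k ℕ.+ 2 ℕ.* d)
      double = ℕ-solve-∀
      shuffle : ∀ k d → k ℕ.+ 2 ℕ.* d ℕ.+ 2 ≡ 2 ℕ.+ (k ℕ.+ d) ℕ.+ d
      shuffle = ℕ-solve-∀
      right-top : 2 ℕ.* (k ℕ.+ d) ∸ k ℕ.+ 2 ≡ a ℕ.+ d
      right-top = trans (cong (λ t → t ∸ k ℕ.+ 2) (double k d))
                        (trans (cong (ℕ._+ 2) (ℕ.m+n∸m≡n k (k ℕ.+ 2 ℕ.* d))) (shuffle k d))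

  -- The Catalan series

  module Catalan (c : Series) (c-equation : X ⊛ (c ⊛ c) ≈ c ⊖ one) where

    h D : Series
    h = X ⊛ c
    D = deriv (X ⊛ (c ⊛ c))

    derSha : Matrix
    derSha = Der c (X ⊛ (c ⊛ c))

    D≈c′ : D ≈ deriv c
    D≈c′ = deriv-cong-suc {X ⊛ (c ⊛ c)} {c} (λ n → trans (c-equation (suc n)) (+-identityʳ (c (suc n))))

    h-square : h ⊛ h ≈ h ⊖ X
    h-square n = begin
      (h ⊛ h) n                    ≡⟨ regroup n ⟩
      (X ⊛ (X ⊛ (c ⊛ c))) n        ≡⟨ ⊛-cong {X} ≈-refl c-equation n ⟩
      (X ⊛ (c ⊖ one)) n            ≡⟨ expand n ⟩
      (h ⊖ X) n                    ∎
      where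
      open SeriesSolver
      regroup : h ⊛ h ≈ X ⊛ (X ⊛ (c ⊛ c))
      regroup = solve 2 (λ t c → (t :* c) :* (t :* c) := t :* (t :* (c :* c))) ≈-refl X c
      expand : X ⊛ (c ⊖ one) ≈ h ⊖ X
      expand = solve 2 (λ t c → t :* (c :- t :^ 0) := t :* c :- t) ≈-refl X c

    c⊛[1-h]≈1 : c ⊛ (one ⊖ h) ≈ one
    c⊛[1-h]≈1 n = begin
      (c ⊛ (one ⊖ h)) n            ≡⟨ expand n ⟩
      (c ⊖ X ⊛ (c ⊛ c)) n          ≡⟨ ⊖-cong {c} ≈-refl c-equation n ⟩
      (c ⊖ (c ⊖ one)) n            ≡⟨ cancel n ⟩
      one n                        ∎
      where
      open SeriesSolver
      expand : c ⊛ (one ⊖ h) ≈ c ⊖ X ⊛ (c ⊛ c)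
      expand = solve 2 (λ t c → c :* (t :^ 0 :- t :* c) := c :- t :* (c :* c)) ≈-refl X c
      cancel : c ⊖ (c ⊖ one) ≈ one
      cancel = solve 2 (λ t c → c :- (c :- t :^ 0) := t :^ 0) ≈-refl X c

    -- Differentiating t c² = c - 1.
    D-equation : D ≈ (c ⊛ c) ⊕ κ (+ 2) ⊛ (h ⊛ D)
    D-equation n = begin
      D n                                                   ≡⟨ deriv-⊛ X (c ⊛ c) n ⟩
      ((deriv X ⊛ (c ⊛ c)) ⊕ (X ⊛ deriv (c ⊛ c))) n        ≡⟨ ⊕-cong (⊛-cong {g = c ⊛ c} deriv-X ≈-refl)
                                                                      (⊛-cong {X} ≈-refl (deriv-⊛ c c)) n ⟩
      ((one ⊛ (c ⊛ c)) ⊕ (X ⊛ ((deriv c ⊛ c) ⊕ (c ⊛ deriv c)))) n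
                                                            ≡⟨ ⊕-cong {one ⊛ (c ⊛ c)} ≈-refl
                                                                 (⊛-cong {X} ≈-refl (⊕-cong (⊛-cong {g = c} c′≈D ≈-refl)
                                                                                            (⊛-cong {c} ≈-refl c′≈D))) n ⟩
      ((one ⊛ (c ⊛ c)) ⊕ (X ⊛ ((D ⊛ c) ⊕ (c ⊛ D)))) n       ≡⟨ collect n ⟩
      ((c ⊛ c) ⊕ κ (+ 2) ⊛ (h ⊛ D)) n                      ∎
      where
      open SeriesSolver
      c′≈D = ≈-sym D≈c′
      collect : (one ⊛ (c ⊛ c)) ⊕ (X ⊛ ((D ⊛ c) ⊕ (c ⊛ D))) ≈ (c ⊛ c) ⊕ κ (+ 2) ⊛ (h ⊛ D)
      collect = solve 3 (λ t c d → t :^ 0 :* (c :* c) :+ t :* (d :* c :+ c :* d)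
                                    := c :* c :+ con (+ 2) :* ((t :* c) :* d)) ≈-refl X c D

    D⊛[1-2h]≈c² : D ⊛ (one ⊖ κ (+ 2) ⊛ h) ≈ c ⊛ c
    D⊛[1-2h]≈c² n = begin
      (D ⊛ (one ⊖ κ (+ 2) ⊛ h)) n                              ≡⟨ expand n ⟩
      (D ⊖ κ (+ 2) ⊛ (h ⊛ D)) n                                ≡⟨ ⊖-cong {g = κ (+ 2) ⊛ (h ⊛ D)} D-equation ≈-refl n ⟩
      (((c ⊛ c) ⊕ κ (+ 2) ⊛ (h ⊛ D)) ⊖ κ (+ 2) ⊛ (h ⊛ D)) n    ≡⟨ cancel n ⟩
      (c ⊛ c) n                                                ∎
      where
      open SeriesSolver
      expand : D ⊛ (one ⊖ κ (+ 2) ⊛ h) ≈ D ⊖ κ (+ 2) ⊛ (h ⊛ D)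
      expand = solve 2 (λ d h → d :* (h :^ 0 :- con (+ 2) :* h) := d :- con (+ 2) :* (h :* d)) ≈-refl D h
      cancel : ((c ⊛ c) ⊕ κ (+ 2) ⊛ (h ⊛ D)) ⊖ κ (+ 2) ⊛ (h ⊛ D) ≈ c ⊛ c
      cancel = solve 2 (λ a b → (a :+ b) :- b := a) ≈-refl (c ⊛ c) (κ (+ 2) ⊛ (h ⊛ D))

    -- D (1 - h)² (1 - 2h) = c² (1 - h)² = 1, expanded in powers of h.
    D-inverse : ((D ⊛ pow h 0 ⊖ κ (+ 4) ⊛ (D ⊛ pow h 1)) ⊕ κ (+ 5) ⊛ (D ⊛ pow h 2)) ⊖ κ (+ 2) ⊛ (D ⊛ pow h 3) ≈ one
    D-inverse n = begin
      (((D ⊛ pow h 0 ⊖ κ (+ 4) ⊛ (D ⊛ pow h 1)) ⊕ κ (+ 5) ⊛ (D ⊛ pow h 2)) ⊖ κ (+ 2) ⊛ (D ⊛ pow h 3)) n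
                                                            ≡⟨ factor n ⟩
      ((D ⊛ (one ⊖ κ (+ 2) ⊛ h)) ⊛ ((one ⊖ h) ⊛ (one ⊖ h))) n
                                                            ≡⟨ ⊛-cong {g = (one ⊖ h) ⊛ (one ⊖ h)} D⊛[1-2h]≈c² ≈-refl n ⟩
      ((c ⊛ c) ⊛ ((one ⊖ h) ⊛ (one ⊖ h))) n                 ≡⟨ regroup n ⟩
      ((c ⊛ (one ⊖ h)) ⊛ (c ⊛ (one ⊖ h))) n                 ≡⟨ ⊛-cong c⊛[1-h]≈1 c⊛[1-h]≈1 n ⟩
      (one ⊛ one) n                                         ≡⟨ ⊛-identityˡ one n ⟩
      one n                                                 ∎
      where
      open SeriesSolver
      factor : ((D ⊛ pow h 0 ⊖ κ (+ 4) ⊛ (D ⊛ pow h 1)) ⊕ κ (+ 5) ⊛ (D ⊛ pow h 2)) ⊖ κ (+ 2) ⊛ (D ⊛ pow h 3)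
                 ≈ (D ⊛ (one ⊖ κ (+ 2) ⊛ h)) ⊛ ((one ⊖ h) ⊛ (one ⊖ h))
      factor = solve 2 (λ d h → d :* h :^ 0 :- con (+ 4) :* (d :* h :^ 1) :+ con (+ 5) :* (d :* h :^ 2)
                                 :- con (+ 2) :* (d :* h :^ 3)
                               := (d :* (h :^ 0 :- con (+ 2) :* h)) :* ((h :^ 0 :- h) :* (h :^ 0 :- h))) ≈-refl D h
      regroup : (c ⊛ c) ⊛ ((one ⊖ h) ⊛ (one ⊖ h)) ≈ (c ⊛ (one ⊖ h)) ⊛ (c ⊛ (one ⊖ h))
      regroup = solve 2 (λ a b → (a :* a) :* (b :* b) := (a :* b) :* (a :* b)) ≈-refl c (one ⊖ h)

    pow-h-shift : ∀ k → D ⊛ pow h (suc k) ≈ X ⊛ (D ⊛ pow h k) ⊕ D ⊛ pow h (suc (suc k))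
    pow-h-shift k n = sym (begin
      (X ⊛ (D ⊛ P) ⊕ D ⊛ (h ⊛ (h ⊛ P))) n      ≡⟨ regroup n ⟩
      (X ⊛ (D ⊛ P) ⊕ (D ⊛ P) ⊛ (h ⊛ h)) n      ≡⟨ ⊕-cong {X ⊛ (D ⊛ P)} ≈-refl (⊛-cong {D ⊛ P} ≈-refl h-square) n ⟩
      (X ⊛ (D ⊛ P) ⊕ (D ⊛ P) ⊛ (h ⊖ X)) n      ≡⟨ collect n ⟩
      (D ⊛ (h ⊛ P)) n                          ∎)
      where
      open SeriesSolver
      P = pow h k
      regroup : X ⊛ (D ⊛ P) ⊕ D ⊛ (h ⊛ (h ⊛ P)) ≈ X ⊛ (D ⊛ P) ⊕ (D ⊛ P) ⊛ (h ⊛ h)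
      regroup = solve 4 (λ t d p h → t :* (d :* p) :+ d :* (h :* (h :* p)) := t :* (d :* p) :+ (d :* p) :* (h :* h))
                        ≈-refl X D P h
      collect : X ⊛ (D ⊛ P) ⊕ (D ⊛ P) ⊛ (h ⊖ X) ≈ D ⊛ (h ⊛ P)
      collect = solve 4 (λ t d p h → t :* (d :* p) :+ (d :* p) :* (h :- t) := d :* (h :* p)) ≈-refl X D P h

    derSha-recurrences : DerShaRecurrences derSha
    derSha-recurrences = record
      { lowerTriangular = riordan-lowerTriangular D refl
      ; shift           = λ n k → trans (pow-h-shift k (suc n))
                                        (cong (_+ derSha (suc n) (suc (suc k))) (X-⊛-suc (D ⊛ pow h k) n))
      ; column₀         = column₀ }
      where
      column₀ : ∀ n → derSha n 0 - + 4 * derSha n 1 + + 5 * derSha n 2 - + 2 * derSha n 3 ≡ one n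
      column₀ n = trans (sym (cong₂ _-_ (cong₂ _+_ (cong (_-_ (derSha n 0)) (κ-⊛ (+ 4) (D ⊛ pow h 1) n))
                                                   (κ-⊛ (+ 5) (D ⊛ pow h 2) n))
                                        (κ-⊛ (+ 2) (D ⊛ pow h 3) n)))
                        (D-inverse n)

open Riordan
open import Data.Nat using (ℕ; _≤_; _+_; _*_; _∸_)
open import Data.Nat.Combinatorics using (_C_)
open import Data.Integer using (ℤ; +_)
open import Data.Product using (_×_; _,_)
open import Relation.Binary.PropositionalEquality using (_≡_; trans; sym)

theorem5p11 : (c : Series) → (∀ n → (X ⊛ (c ⊛ c)) n ≡ (c ⊖ one) n) →
    (∀ n k → Der c (X ⊛ (c ⊛ c)) n k ≡ riordan (deriv c) (X ⊛ c) n k)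
    × IsInverse (Der c (X ⊛ (c ⊛ c)))
        (riordan ((one ⊖ X) ⊛ ((one ⊖ X) ⊛ (one ⊖ (X ⊕ X)))) (X ⊖ (X ⊛ X)))
    × (∀ n k → k ≤ n → Der c (X ⊛ (c ⊛ c)) n k ≡ + ((2 * n ∸ k + 2) C (n ∸ k)))
theorem5p11 c c-equation = derSha≡riordan , derSha-inverse , derSha-entries
  where
  open Catalan c c-equation
  open DerShaRecurrences

  derSha≡riordan : ∀ n k → derSha n k ≡ riordan (deriv c) h n k
  derSha≡riordan n k = ⊛-cong {g = pow h k} D≈c′ ≈-refl n

  derSha-inverse : IsInverse derSha invDerSha
  derSha-inverse = rightInverse⇒isInverse (lowerTriangular derSha-recurrences)
    invDerSha-lowerTriangular invDerSha-unitDiagonal (derShaRecurrences⇒⊠-invDerSha derSha-recurrences)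

  derSha≡binomialArray : ∀ n k → derSha n k ≡ binomialArray n k
  derSha≡binomialArray = ⊠-cancelʳ (lowerTriangular derSha-recurrences)
    (lowerTriangular binomialArray-recurrences) invDerSha-lowerTriangular invDerSha-unitDiagonal
    (λ n k → trans (derShaRecurrences⇒⊠-invDerSha derSha-recurrences n k)
                   (sym (derShaRecurrences⇒⊠-invDerSha binomialArray-recurrences n k)))

  derSha-entries : ∀ n k → k ≤ n → derSha n k ≡ + ((2 * n ∸ k + 2) C (n ∸ k))
  derSha-entries n k k≤n = trans (derSha≡binomialArray n k) (binomialArray-entry k≤n)
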